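{- Let $n\ge 1$ and let $\bar o=(\bar o_1,\dots,\bar o_n)$ be an $n$-tuple of operators, each $\bar o_i\in\mathcal O_n$. Consider the two problems \[ P(\bar o)\colon\quad \bar x\in\mathbb{Q}^n,\qquad \bar x<\bar o(\bar x), \] \[ D(\bar o)\colon\quad \bar y\in(\mathbb{Q}\cup\{+\infty\})^n\setminus\{+\infty\}^n,\qquad \bar y\ge \bar o(\bar y), \] where the inequalities are required to hold component-wise, i.e. $x_i<\bar o_i(\bar x)$ for all $i$ (resp. $y_i\ge \bar o_i(\bar y)$ for all $i$). Then exactly one of $P(\bar o)$ and $D(\bar o)$ is satisfiable.
   Context: $\mathcal O_n$ denotes the class of functions $(\mathbb{Q}\cup\{+\infty\})^n\to\mathbb{Q}\cup\{+\infty\}$ of one of the following three forms, for some $m\ge1$, indices $j_1,\dots,j_m\in\{1,\dots,n\}$, rationals $k,k_1,\dots,k_m\in\mathbb{Q}$ and positive rationals $\alpha_1,\dots,\alpha_m$: (i) $(x_1,\dots,x_n)\mapsto \max(x_{j_1}+k_1,\dots,x_{j_m}+k_m)$; (ii) $(x_1,\dots,x_n)\mapsto \min(x_{j_1}+k_1,\dots,x_{j_m}+k_m)$; (iii) $(x_1,\dots,x_n)\mapsto \frac{\alpha_1x_{j_1}+\dots+\alpha_mx_{j_m}}{\alpha_1+\dots+\alpha_m}+k$. Arithmetic and order with $+\infty$ follow the usual conventions: $+\infty+c=+\infty$, $\alpha\cdot(+\infty)=+\infty$ for $\alpha>0$, a sum containing $+\infty$ equals $+\infty$, $c<+\infty$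 for every rational $c$, and $+\infty\ge+\infty$. -}

module Defs where

open import Data.Nat using (ℕ)
open import Data.Fin using (Fin)
open import Data.Product using (Σ; _×_; _,_; proj₁; proj₂; ∃-syntax)
open import Data.List.NonEmpty using (List⁺; _∷_; foldr₁)
open import Data.List using (List; []; _∷_)
open import Data.Rational using (ℚ; 0ℚ; _+_; _*_; _<_; _≤_; _>_; _⊔_; _⊓_; 1/_; positive)
open import Data.Rational.Properties using (+-mono-<; +-identityʳ; pos⇒nonZero)
open import Relation.Binary.PropositionalEquality using (_≡_; subst)
open import Relation.Nullary using (¬_)

data ℚ∞ : Set where
  fin : ℚ → ℚ∞
  +∞  : ℚ∞

_+ᶜ_ : ℚ∞ → ℚ → ℚ∞
fin a +ᶜ c = fin (a + c)
+∞    +ᶜ c = +∞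

_⊕_ : ℚ∞ → ℚ∞ → ℚ∞
fin a ⊕ fin b = fin (a + b)
fin a ⊕ +∞    = +∞
+∞    ⊕ _     = +∞

_·_ : ℚ → ℚ∞ → ℚ∞
α · fin a = fin (α * a)
α · +∞    = +∞

max∞ : ℚ∞ → ℚ∞ → ℚ∞
max∞ (fin a) (fin b) = fin (a ⊔ b)
max∞ (fin a) +∞      = +∞
max∞ +∞      _       = +∞

min∞ : ℚ∞ → ℚ∞ → ℚ∞
min∞ (fin a) (fin b) = fin (a ⊓ b)
min∞ (fin a) +∞      = fin a
min∞ +∞      y       = y

infix 4 _<∞_ _≤∞_

data _<∞_ : ℚ∞ → ℚ∞ → Set where
  fin<fin : ∀ {a b} → a < b → fin a <∞ fin b
  fin<∞   : ∀ {a} → fin a <∞ +∞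

data _≤∞_ : ℚ∞ → ℚ∞ → Set where
  fin≤fin : ∀ {a b} → a ≤ b → fin a ≤∞ fin b
  ≤+∞     : ∀ {x} → x ≤∞ +∞

ℚ>0 : Set
ℚ>0 = Σ ℚ (λ α → α > 0ℚ)

-- The class O_n of operators.
--  maxOp ((j₁ , k₁) ∷ …) : x ↦ max(x_{j₁}+k₁, …, x_{jₘ}+kₘ)
--  minOp ((j₁ , k₁) ∷ …) : x ↦ min(x_{j₁}+k₁, …, x_{jₘ}+kₘ)
--  avgOp ((j₁ , α₁) ∷ …) k : x ↦ (α₁x_{j₁}+…+αₘx_{jₘ})/(α₁+…+αₘ) + k
data Op (n : ℕ) : Set where
  maxOp : List⁺ (Fin n × ℚ) → Op n
  minOp : List⁺ (Fin n × ℚ) → Op n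
  avgOp : List⁺ (Fin n × ℚ>0) → ℚ → Op n

totalWeight : ∀ {n} → List⁺ (Fin n × ℚ>0) → ℚ>0
totalWeight {n} (w ∷ ws) = go w ws
  where
  go : Fin n × ℚ>0 → List (Fin n × ℚ>0) → ℚ>0
  go (_ , α) []       = α
  go (_ , (a , a>0)) (v ∷ vs) with go v vs
  ... | (s , s>0) = (a + s , subst (_< a + s) (+-identityʳ 0ℚ) (+-mono-< a>0 s>0))

weightedSum : ∀ {n} → (Fin n → ℚ∞) → List⁺ (Fin n × ℚ>0) → ℚ∞
weightedSum x ws = foldr₁ _⊕_ (Data.List.NonEmpty.map (λ { (j , (α , _)) → α · x j }) ws)

divPos : ℚ∞ → ℚ>0 → ℚ∞
divPos v (s , s>0) = (1/_ s {{pos⇒nonZero s {{positive s>0}}}}) · v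

eval : ∀ {n} → Op n → (Fin n → ℚ∞) → ℚ∞
eval (maxOp ts) x = foldr₁ max∞ (Data.List.NonEmpty.map (λ { (j , k) → x j +ᶜ k }) ts)
eval (minOp ts) x = foldr₁ min∞ (Data.List.NonEmpty.map (λ { (j , k) → x j +ᶜ k }) ts)
eval (avgOp ws k) x = divPos (weightedSum x ws) (totalWeight ws) +ᶜ k

P : ∀ {n} → (Fin n → Op n) → Set
P {n} o = Σ (Fin n → ℚ) λ x → ∀ i → fin (x i) <∞ eval (o i) (λ j → fin (x j))

D : ∀ {n} → (Fin n → Op n) → Set
D {n} o = Σ (Fin n → ℚ∞) λ y → (¬ (∀ i → y i ≡ +∞)) × (∀ i → eval (o i) y ≤∞ y i)

-- Induction on n, eliminating x₀ Fourier–Motzkin style. The operators are generalised to terms built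
-- from +∞, −∞, binary max and min, and affine maps Σⱼ cⱼ xⱼ + k with cⱼ ≥ 0 and Σⱼ cⱼ = 1, evaluated at
-- points of (ℚ ∪ {+∞})ⁿ with values in ℚ ∪ {−∞, +∞}; such terms are monotone and commute with
-- translations x ↦ x + t. For rational z the condition z < f₀(z, x′) is equivalent to z < g(x′) for
-- an explicit term g: in an affine map with weight c < 1 on x₀ it solves to z < (L + k)/(1 − c), and
-- for c = 1 it is the constant condition k > 0. Substituting g for x₀ in the other equations leaves a
-- system in n − 1 variables. A strict subsolution x′ of it extends by a rational x₀ slightly below
-- g(x′), since terms are continuous from below in x₀ and only finitely many strict inequalities must
-- be kept; a supersolution y′ extends by y₀ = g(y′); and if g ≡ −∞ then (0, +∞, …, +∞) is a
-- supersolution. The two problems exclude each other: moving a strict subsolution x up to x + t, with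
-- t = minⱼ (yⱼ − xⱼ), makes it touch a supersolution y at some i, and then
-- yᵢ = xᵢ + t < fᵢ(x + t) ≤ fᵢ(y) ≤ yᵢ.

module Submission where

open import Defs

module Rationals where

  open import Data.Rational using (0ℚ; 1ℚ; _+_; _*_; _-_; -_; 1/_; _≤_; _<_; NonZero; Positive; positive)
  import Data.Rational.Properties as ℚ
  open import Data.Rational.Solver using (module +-*-Solver)
  open import Data.Empty using (⊥-elim)
  open import Data.Product using (∃-syntax; _×_; _,_)
  open import Function using (_⇔_; mk⇔)
  open import Relation.Binary.PropositionalEquality
  open import Relation.Nullary using (yes; no)
  open +-*-Solver using (solve; _:+_; _:*_; _:-_; :-_; con; _:=_)

  pos-inverse : ∀ {d} → 0ℚ < d → ∃[ s ] d * s ≡ 1ℚ × 0ℚ < s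
  pos-inverse {d} 0<d = 1/ d , ℚ.*-inverseʳ d , ℚ.positive⁻¹ (1/ d) {{ℚ.1/pos⇒pos d}}
    where
    instance
      d-pos : Positive d
      d-pos = positive 0<d
      d-nonZero : NonZero d
      d-nonZero = ℚ.pos⇒nonZero d

  ≤∧≢⇒< : ∀ {a b} → a ≤ b → a ≢ b → a < b
  ≤∧≢⇒< {a} {b} a≤b a≢b with a ℚ.<? b
  ... | yes a<b = a<b
  ... | no  a≮b = ⊥-elim (a≢b (ℚ.≤-antisym a≤b (ℚ.≮⇒≥ a≮b)))

  nonNeg+nonNeg≡0 : ∀ {a b} → 0ℚ ≤ a → 0ℚ ≤ b → a + b ≡ 0ℚ → a ≡ 0ℚ × b ≡ 0ℚ
  nonNeg+nonNeg≡0 {a} {b} 0≤a 0≤b a+b≡0 =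
    ℚ.≤-antisym (subst (a ≤_) a+b≡0 (subst (_≤ a + b) (ℚ.+-identityʳ a) (ℚ.+-monoʳ-≤ a 0≤b))) 0≤a ,
    ℚ.≤-antisym (subst (b ≤_) a+b≡0 (subst (_≤ a + b) (ℚ.+-identityˡ b) (ℚ.+-monoˡ-≤ b 0≤a))) 0≤b

  x<c*x+m⇔[1-c]*x<m : ∀ c x m → x < c * x + m ⇔ (1ℚ - c) * x < m
  x<c*x+m⇔[1-c]*x<m c x m = mk⇔
    (λ lt → subst₂ _<_ (solve 2 (λ c x → x :+ :- (c :* x) := (con 1ℚ :- c) :* x) refl c x)
                       (solve 3 (λ c x m → c :* x :+ m :+ :- (c :* x) := m) refl c x m)
                       (ℚ.+-monoˡ-< (- (c * x)) lt))
    (λ lt → subst₂ _<_ (solve 2 (λ c x → (con 1ℚ :- c) :* x :+ c :* x := x) refl c x)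
                       (solve 3 (λ c x m → m :+ c :* x := c :* x :+ m) refl c x m)
                       (ℚ.+-monoˡ-< (c * x) lt))

  d*x<m⇔x<s*m : ∀ {d s} → d * s ≡ 1ℚ → 0ℚ < d → 0ℚ < s → ∀ x m → d * x < m ⇔ x < s * m
  d*x<m⇔x<s*m {d} {s} ds≡1 0<d 0<s x m = mk⇔
    (λ lt → subst (_< s * m) (cancel s d x (trans (ℚ.*-comm s d) ds≡1)) (ℚ.*-monoʳ-<-pos s {{positive 0<s}} lt))
    (λ lt → subst (d * x <_) (cancel d s m ds≡1) (ℚ.*-monoʳ-<-pos d {{positive 0<d}} lt))
    where
    cancel : ∀ a b y → a * b ≡ 1ℚ → a * (b * y) ≡ y
    cancel a b y ab≡1 = trans (sym (ℚ.*-assoc a b y)) (trans (cong (_* y) ab≡1) (ℚ.*-identityˡ y))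

  x<x+k⇔0<k : ∀ x k → x < x + k ⇔ 0ℚ < k
  x<x+k⇔0<k x k = mk⇔
    (λ lt → subst₂ _<_ (ℚ.+-inverseˡ x) (solve 2 (λ x k → :- x :+ (x :+ k) := k) refl x k) (ℚ.+-monoʳ-< (- x) lt))
    (λ lt → subst (_< x + k) (ℚ.+-identityʳ x) (ℚ.+-monoʳ-< x lt))

module ExtendedRationals where

  open Rationals
  open import Data.Rational
    using (ℚ; 0ℚ; 1ℚ; _+_; _*_; _-_; -_; _≤_; _<_; _⊔_; nonNegative; positive)
  import Data.Rational.Properties as ℚ
  open import Data.Rational.Solver using (module +-*-Solver)
  open import Data.Empty using (⊥-elim)
  open import Data.Product using (∃-syntax; _×_; _,_; proj₁; proj₂)
  open import Data.Sum using (_⊎_; inj₁; inj₂)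
  open import Function using (_⇔_; mk⇔)
  import Function.Properties.Equivalence as ⇔
  open import Algebra.Bundles using (CommutativeMonoid)
  open import Relation.Binary.Bundles using (TotalOrder)
  open import Relation.Binary.Structures using (IsTotalOrder)
  open import Relation.Binary.PropositionalEquality
  open ≡-Reasoning
  open import Relation.Nullary using (¬_; Dec; yes; no)
  open +-*-Solver using (solve; _:+_; _:*_; _:-_; :-_; con; _:=_)

  ≤∞-refl : ∀ {x} → x ≤∞ x
  ≤∞-refl {fin a} = fin≤fin ℚ.≤-refl
  ≤∞-refl {+∞}    = ≤+∞

  ≤∞-reflexive : ∀ {x y} → x ≡ y → x ≤∞ y
  ≤∞-reflexive refl = ≤∞-refl

  ≤∞-trans : ∀ {x y z} → x ≤∞ y → y ≤∞ z → x ≤∞ z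
  ≤∞-trans (fin≤fin p) (fin≤fin q) = fin≤fin (ℚ.≤-trans p q)
  ≤∞-trans _           ≤+∞         = ≤+∞

  ≤∞-antisym : ∀ {x y} → x ≤∞ y → y ≤∞ x → x ≡ y
  ≤∞-antisym (fin≤fin p) (fin≤fin q) = cong fin (ℚ.≤-antisym p q)
  ≤∞-antisym ≤+∞         ≤+∞         = refl

  ≤∞-total : ∀ x y → x ≤∞ y ⊎ y ≤∞ x
  ≤∞-total (fin a) (fin b) with ℚ.≤-total a b
  ... | inj₁ a≤b = inj₁ (fin≤fin a≤b)
  ... | inj₂ b≤a = inj₂ (fin≤fin b≤a)
  ≤∞-total _       +∞      = inj₁ ≤+∞
  ≤∞-total +∞      (fin b) = inj₂ ≤+∞

  ≤∞-isTotalOrder : IsTotalOrder _≡_ _≤∞_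
  ≤∞-isTotalOrder = record
    { isPartialOrder = record
      { isPreorder = record
        { isEquivalence = isEquivalence
        ; reflexive     = ≤∞-reflexive
        ; trans         = ≤∞-trans
        }
      ; antisym = ≤∞-antisym
      }
    ; total = ≤∞-total
    }

  ≤∞-totalOrder : TotalOrder _ _ _
  ≤∞-totalOrder = record { isTotalOrder = ≤∞-isTotalOrder }

  <∞-≤∞-trans : ∀ {x y z} → x <∞ y → y ≤∞ z → x <∞ z
  <∞-≤∞-trans (fin<fin p) (fin≤fin q) = fin<fin (ℚ.<-≤-trans p q)
  <∞-≤∞-trans (fin<fin p) ≤+∞         = fin<∞
  <∞-≤∞-trans fin<∞       ≤+∞         = fin<∞

  <∞⇒≱∞ : ∀ {x y} → x <∞ y → ¬ (y ≤∞ x)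
  <∞⇒≱∞ (fin<fin p) (fin≤fin q) = ℚ.<-irrefl refl (ℚ.<-≤-trans p q)

  fin<∞⊎≥ : ∀ q y → fin q <∞ y ⊎ y ≤∞ fin q
  fin<∞⊎≥ q (fin b) with q ℚ.<? b
  ... | yes q<b = inj₁ (fin<fin q<b)
  ... | no  q≮b = inj₂ (fin≤fin (ℚ.≮⇒≥ q≮b))
  fin<∞⊎≥ q +∞ = inj₁ fin<∞

  fin-below : ∀ y → ∃[ z ] fin z <∞ y
  fin-below (fin w) = w - 1ℚ , fin<fin (subst (w - 1ℚ <_) (ℚ.+-identityʳ w) (ℚ.+-monoʳ-< w (ℚ.negative⁻¹ (- 1ℚ))))
  fin-below +∞      = 0ℚ , fin<∞

  fin<∞-dense : ∀ {q y} → fin q <∞ y → ∃[ r ] q < r × fin r <∞ y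
  fin<∞-dense (fin<fin q<b) with ℚ.<-dense q<b
  ... | r , q<r , r<b = r , q<r , fin<fin r<b
  fin<∞-dense {q} fin<∞ = q + 1ℚ , subst (_< q + 1ℚ) (ℚ.+-identityʳ q) (ℚ.+-monoʳ-< q (ℚ.positive⁻¹ 1ℚ)) , fin<∞

  ≡+∞? : ∀ x → Dec (x ≡ +∞)
  ≡+∞? (fin a) = no λ ()
  ≡+∞? +∞      = yes refl

  ≢+∞⇒fin : ∀ {x} → x ≢ +∞ → ∃[ a ] x ≡ fin a
  ≢+∞⇒fin {fin a} _    = a , refl
  ≢+∞⇒fin {+∞}    x≢+∞ = ⊥-elim (x≢+∞ refl)

  ≤fin⇒fin : ∀ {x a} → x ≤∞ fin a → ∃[ b ] x ≡ fin b
  ≤fin⇒fin (fin≤fin {b} _) = b , refl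

  +ᶜ-mono : ∀ k {x y} → x ≤∞ y → x +ᶜ k ≤∞ y +ᶜ k
  +ᶜ-mono k (fin≤fin p) = fin≤fin (ℚ.+-monoˡ-≤ k p)
  +ᶜ-mono k ≤+∞         = ≤+∞

  ⊕-comm : ∀ x y → x ⊕ y ≡ y ⊕ x
  ⊕-comm (fin a) (fin b) = cong fin (ℚ.+-comm a b)
  ⊕-comm (fin a) +∞      = refl
  ⊕-comm +∞      (fin b) = refl
  ⊕-comm +∞      +∞      = refl

  ⊕-assoc : ∀ x y z → (x ⊕ y) ⊕ z ≡ x ⊕ (y ⊕ z)
  ⊕-assoc (fin a) (fin b) (fin c) = cong fin (ℚ.+-assoc a b c)
  ⊕-assoc (fin a) (fin b) +∞      = refl
  ⊕-assoc (fin a) +∞      z       = refl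
  ⊕-assoc +∞      y       z       = refl

  ⊕-identityˡ : ∀ x → fin 0ℚ ⊕ x ≡ x
  ⊕-identityˡ (fin a) = cong fin (ℚ.+-identityˡ a)
  ⊕-identityˡ +∞      = refl

  ⊕-identityʳ : ∀ x → x ⊕ fin 0ℚ ≡ x
  ⊕-identityʳ x = trans (⊕-comm x (fin 0ℚ)) (⊕-identityˡ x)

  ⊕-commutativeMonoid : CommutativeMonoid _ _
  ⊕-commutativeMonoid = record
    { _≈_ = _≡_
    ; _∙_ = _⊕_
    ; ε   = fin 0ℚ
    ; isCommutativeMonoid = record
      { isMonoid = record
        { isSemigroup = record
          { isMagma = record { isEquivalence = isEquivalence ; ∙-cong = cong₂ _⊕_ }
          ; assoc   = ⊕-assoc
          }
        ; identity = ⊕-identityˡ , ⊕-identityʳ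
        }
      ; comm = ⊕-comm
      }
    }

  ⊕-mono : ∀ {x x′ y y′} → x ≤∞ x′ → y ≤∞ y′ → x ⊕ y ≤∞ x′ ⊕ y′
  ⊕-mono (fin≤fin p) (fin≤fin q)       = fin≤fin (ℚ.+-mono-≤ p q)
  ⊕-mono {x′ = fin _} (fin≤fin p) ≤+∞ = ≤+∞
  ⊕-mono {x′ = +∞}    _           _   = ≤+∞

  ⊕-+ᶜ : ∀ x y k → (x ⊕ y) +ᶜ k ≡ x ⊕ (y +ᶜ k)
  ⊕-+ᶜ (fin a) (fin b) k = cong fin (ℚ.+-assoc a b k)
  ⊕-+ᶜ (fin a) +∞      k = refl
  ⊕-+ᶜ +∞      y       k = refl

  ·-mono : ∀ {α} → 0ℚ ≤ α → ∀ {x y} → x ≤∞ y → (α · x) ≤∞ (α · y)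
  ·-mono {α} 0≤α (fin≤fin p) = fin≤fin (ℚ.*-monoˡ-≤-nonNeg α {{nonNegative 0≤α}} p)
  ·-mono     0≤α ≤+∞         = ≤+∞

  ·-distrib-⊕ : ∀ α x y → α · (x ⊕ y) ≡ (α · x) ⊕ (α · y)
  ·-distrib-⊕ α (fin a) (fin b) = cong fin (ℚ.*-distribˡ-+ α a b)
  ·-distrib-⊕ α (fin a) +∞      = refl
  ·-distrib-⊕ α +∞      y       = refl

  ·-distrib-+ᶜ : ∀ α x k → α · (x +ᶜ k) ≡ (α · x) +ᶜ (α * k)
  ·-distrib-+ᶜ α (fin a) k = cong fin (ℚ.*-distribˡ-+ α a k)
  ·-distrib-+ᶜ α +∞      k = refl

  ·-assoc : ∀ α β x → (α * β) · x ≡ α · (β · x)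
  ·-assoc α β (fin a) = cong fin (ℚ.*-assoc α β a)
  ·-assoc α β +∞      = refl

  ·-distribʳ-+ : ∀ α β x → (α + β) · x ≡ (α · x) ⊕ (β · x)
  ·-distribʳ-+ α β (fin a) = cong fin (ℚ.*-distribʳ-+ a α β)
  ·-distribʳ-+ α β +∞      = refl

  ·-identityˡ : ∀ x → 1ℚ · x ≡ x
  ·-identityˡ (fin a) = cong fin (ℚ.*-identityˡ a)
  ·-identityˡ +∞      = refl

  +ᶜ-neg-cancel : ∀ x a → (x +ᶜ (- a)) +ᶜ a ≡ x
  +ᶜ-neg-cancel (fin b) a = cong fin (solve 2 (λ b a → b :+ :- a :+ a := b) refl b a)
  +ᶜ-neg-cancel +∞      a = refl

  ⊕-+ᶜ-swap : ∀ x y k p → (x ⊕ y) +ᶜ (k + p) ≡ ((y +ᶜ p) ⊕ x) +ᶜ k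
  ⊕-+ᶜ-swap (fin a) (fin b) k p = cong fin (solve 4 (λ a b k p → a :+ b :+ (k :+ p) := b :+ p :+ a :+ k) refl a b k p)
  ⊕-+ᶜ-swap (fin a) +∞      k p = refl
  ⊕-+ᶜ-swap +∞      (fin b) k p = refl
  ⊕-+ᶜ-swap +∞      +∞      k p = refl

  infixr 30 _⊙_

  -- Scaling by a nonnegative coefficient with the convention 0 ⊙ +∞ = 0 (whereas 0 · +∞ = +∞).
  _⊙_ : ℚ → ℚ∞ → ℚ∞
  c ⊙ fin a = fin (c * a)
  c ⊙ +∞ with 0ℚ ℚ.<? c
  ... | yes _ = +∞
  ... | no  _ = fin 0ℚ

  0⊙ : ∀ x → 0ℚ ⊙ x ≡ fin 0ℚ
  0⊙ (fin a) = cong fin (ℚ.*-zeroˡ a)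
  0⊙ +∞ with 0ℚ ℚ.<? 0ℚ
  ... | yes 0<0 = ⊥-elim (ℚ.<-irrefl refl 0<0)
  ... | no  _   = refl

  pos⊙ : ∀ {c} → 0ℚ < c → ∀ x → c ⊙ x ≡ c · x
  pos⊙ 0<c (fin a) = refl
  pos⊙ {c} 0<c +∞ with 0ℚ ℚ.<? c
  ... | yes _   = refl
  ... | no  0≮c = ⊥-elim (0≮c 0<c)

  nonNeg-split : ∀ {c} → 0ℚ ≤ c → c ≡ 0ℚ ⊎ 0ℚ < c
  nonNeg-split {c} 0≤c with 0ℚ ℚ.<? c
  ... | yes 0<c = inj₂ 0<c
  ... | no  0≮c = inj₁ (ℚ.≤-antisym (ℚ.≮⇒≥ 0≮c) 0≤c)

  ⊙-mono : ∀ {c} → 0ℚ ≤ c → ∀ {x y} → x ≤∞ y → c ⊙ x ≤∞ c ⊙ y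
  ⊙-mono 0≤c {x} {y} x≤y with nonNeg-split 0≤c
  ... | inj₁ refl = ≤∞-reflexive (trans (0⊙ x) (sym (0⊙ y)))
  ... | inj₂ 0<c  = subst₂ _≤∞_ (sym (pos⊙ 0<c x)) (sym (pos⊙ 0<c y)) (·-mono 0≤c x≤y)

  ⊙-distribʳ-+ : ∀ {c d} → 0ℚ ≤ c → 0ℚ ≤ d → ∀ x → (c + d) ⊙ x ≡ c ⊙ x ⊕ d ⊙ x
  ⊙-distribʳ-+ {c} {d} 0≤c 0≤d x with nonNeg-split 0≤c | nonNeg-split 0≤d
  ... | inj₁ refl | _ = begin
    (0ℚ + d) ⊙ x      ≡⟨ cong (_⊙ x) (ℚ.+-identityˡ d) ⟩
    d ⊙ x             ≡⟨ ⊕-identityˡ (d ⊙ x) ⟨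
    fin 0ℚ ⊕ d ⊙ x    ≡⟨ cong (_⊕ d ⊙ x) (0⊙ x) ⟨
    0ℚ ⊙ x ⊕ d ⊙ x    ∎
  ... | inj₂ _ | inj₁ refl = begin
    (c + 0ℚ) ⊙ x      ≡⟨ cong (_⊙ x) (ℚ.+-identityʳ c) ⟩
    c ⊙ x             ≡⟨ ⊕-identityʳ (c ⊙ x) ⟨
    c ⊙ x ⊕ fin 0ℚ    ≡⟨ cong (c ⊙ x ⊕_) (0⊙ x) ⟨
    c ⊙ x ⊕ 0ℚ ⊙ x    ∎
  ... | inj₂ 0<c | inj₂ 0<d = begin
    (c + d) ⊙ x          ≡⟨ pos⊙ (ℚ.+-mono-< 0<c 0<d) x ⟩
    (c + d) · x          ≡⟨ ·-distribʳ-+ c d x ⟩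
    (c · x) ⊕ (d · x)    ≡⟨ cong₂ _⊕_ (pos⊙ 0<c x) (pos⊙ 0<d x) ⟨
    c ⊙ x ⊕ d ⊙ x        ∎

  ⊙-assoc : ∀ {a} → 0ℚ < a → ∀ {c} → 0ℚ ≤ c → ∀ x → (a * c) ⊙ x ≡ a · (c ⊙ x)
  ⊙-assoc {a} 0<a 0≤c x with nonNeg-split 0≤c
  ... | inj₁ refl = begin
    (a * 0ℚ) ⊙ x    ≡⟨ cong (_⊙ x) (ℚ.*-zeroʳ a) ⟩
    0ℚ ⊙ x          ≡⟨ 0⊙ x ⟩
    fin 0ℚ          ≡⟨ cong fin (ℚ.*-zeroʳ a) ⟨
    a · fin 0ℚ      ≡⟨ cong (a ·_) (0⊙ x) ⟨
    a · (0ℚ ⊙ x)    ∎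
  ... | inj₂ 0<c  = trans (pos⊙ 0<ac x) (trans (·-assoc a _ x) (cong (a ·_) (sym (pos⊙ 0<c x))))
    where 0<ac = ℚ.positive⁻¹ _ {{ℚ.pos*pos⇒pos a {{positive 0<a}} _ {{positive 0<c}}}}

  1⊙ : ∀ x → 1ℚ ⊙ x ≡ x
  1⊙ x = trans (pos⊙ (ℚ.positive⁻¹ 1ℚ) x) (·-identityˡ x)

  fin<fin⇔ : ∀ {a b} → fin a <∞ fin b ⇔ a < b
  fin<fin⇔ = mk⇔ (λ { (fin<fin a<b) → a<b }) fin<fin

  x<c*x+M⇔x<s·M : ∀ {c s} → (1ℚ - c) * s ≡ 1ℚ → 0ℚ < 1ℚ - c → 0ℚ < s →
                  ∀ x M → fin x <∞ fin (c * x) ⊕ M ⇔ fin x <∞ s · M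
  x<c*x+M⇔x<s·M {c} ds≡1 0<d 0<s x (fin m) =
    ⇔.trans fin<fin⇔ (⇔.trans (x<c*x+m⇔[1-c]*x<m c x m)
                      (⇔.trans (d*x<m⇔x<s*m ds≡1 0<d 0<s x m) (⇔.sym fin<fin⇔)))
  x<c*x+M⇔x<s·M ds≡1 0<d 0<s x +∞ = mk⇔ (λ _ → fin<∞) (λ _ → fin<∞)

  Witness : ℚ∞ → (ℚ → Set) → Set
  Witness u Q = ∃[ z ] fin z <∞ u × Q z

  UpClosed : (ℚ → Set) → Set
  UpClosed Q = ∀ {z z′} → z ≤ z′ → Q z → Q z′

  witness-× : ∀ {u Q R} → UpClosed Q → UpClosed R → Witness u Q → Witness u R → Witness u (λ z → Q z × R z)
  witness-× {u} Q↑ R↑ (z₁ , z₁<u , Qz₁) (z₂ , z₂<u , Rz₂) =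
    z₁ ⊔ z₂ , max<u , Q↑ (ℚ.p≤p⊔q z₁ z₂) Qz₁ , R↑ (ℚ.p≤q⊔p z₁ z₂) Rz₂
    where
    max<u : fin (z₁ ⊔ z₂) <∞ u
    max<u with ℚ.⊔-sel z₁ z₂
    ... | inj₁ eq = subst (λ z → fin z <∞ u) (sym eq) z₁<u
    ... | inj₂ eq = subst (λ z → fin z <∞ u) (sym eq) z₂<u

  -- Continuity from below of u ↦ (c ⊙ u ⊕ L) +ᶜ k for c > 0.
  ⊙-witness : ∀ {c} → 0ℚ < c → ∀ L k {q} u → fin q <∞ (c ⊙ u ⊕ L) +ᶜ k →
              Witness u (λ z → fin q <∞ (c ⊙ fin z ⊕ L) +ᶜ k)
  ⊙-witness 0<c +∞ k u _ with fin-below u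
  ... | z , z<u = z , z<u , fin<∞
  ⊙-witness {c} 0<c (fin m) k {q} u q<v with fin<∞-dense q<v
  ... | r , q<r , r<v = z , z<u u r<v , fin<fin (subst (q <_) (sym cz+m+k≡r) q<r)
    where
    s = proj₁ (pos-inverse 0<c)
    z = (r - m - k) * s
    cz+m+k≡r : c * z + m + k ≡ r
    cz+m+k≡r = begin
      c * ((r - m - k) * s) + m + k
        ≡⟨ solve 5 (λ c r m k s → c :* ((r :- m :- k) :* s) :+ m :+ k := (c :* s) :* (r :- m :- k) :+ m :+ k)
                   refl c r m k s ⟩
      (c * s) * (r - m - k) + m + k ≡⟨ cong (λ e → e * (r - m - k) + m + k) (proj₁ (proj₂ (pos-inverse 0<c))) ⟩
      1ℚ * (r - m - k) + m + k      ≡⟨ solve 3 (λ r m k → con 1ℚ :* (r :- m :- k) :+ m :+ k := r) refl r m k ⟩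
      r                             ∎
    z<u : ∀ u → fin r <∞ (c ⊙ u ⊕ fin m) +ᶜ k → fin z <∞ u
    z<u (fin w) (fin<fin r<cw+m+k) = fin<fin (ℚ.*-cancelˡ-<-nonNeg c {{nonNegative (ℚ.<⇒≤ 0<c)}} cz<cw)
      where
      cz<cw : c * z < c * w
      cz<cw = subst₂ _<_ (solve 3 (λ x m k → x :+ m :+ k :+ :- (m :+ k) := x) refl (c * z) m k)
                         (solve 3 (λ x m k → x :+ m :+ k :+ :- (m :+ k) := x) refl (c * w) m k)
                         (ℚ.+-monoˡ-< (- (m + k)) (subst (_< c * w + m + k) (sym cz+m+k≡r) r<cw+m+k))
    z<u +∞      _ = fin<∞

module Values where

  open ExtendedRationals
  open import Data.Rational using (ℚ; _+_)
  import Data.Rational.Properties as ℚ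
  open import Data.Empty using (⊥)
  open import Data.Product using (_×_; _,_)
  open import Data.Sum using (_⊎_; inj₁; inj₂; [_,_]′)
  open import Data.Maybe using (map)
  open import Function using (_⇔_; mk⇔)
  open import Relation.Binary.Bundles using (TotalOrder; TotalPreorder)
  open import Relation.Binary.Structures using (IsTotalOrder)
  open import Relation.Binary.PropositionalEquality
  open import Relation.Nullary using (¬_)
  open import Relation.Nullary.Construct.Add.Infimum public using (_₋; ⊥₋; [_])
  import Relation.Binary.Construct.Add.Infimum.NonStrict as AddInfimum
  open import Algebra.Construct.NaturalChoice.Base using (MaxOperator; MinOperator)
  import Algebra.Construct.NaturalChoice.MaxOp as MaxOp
  import Algebra.Construct.NaturalChoice.MinOp as MinOp

  max∞-≤ : ∀ {x y} → x ≤∞ y → max∞ x y ≡ y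
  max∞-≤ (fin≤fin p)          = cong fin (ℚ.p≤q⇒p⊔q≡q p)
  max∞-≤ {fin a} ≤+∞          = refl
  max∞-≤ {+∞}    ≤+∞          = refl

  max∞-≥ : ∀ {x y} → y ≤∞ x → max∞ x y ≡ x
  max∞-≥ (fin≤fin p)          = cong fin (ℚ.p≥q⇒p⊔q≡p p)
  max∞-≥ {y = fin b} ≤+∞      = refl
  max∞-≥ {y = +∞}    ≤+∞      = refl

  min∞-≤ : ∀ {x y} → x ≤∞ y → min∞ x y ≡ x
  min∞-≤ (fin≤fin p)          = cong fin (ℚ.p≤q⇒p⊓q≡p p)
  min∞-≤ {fin a} ≤+∞          = refl
  min∞-≤ {+∞}    ≤+∞          = refl

  min∞-≥ : ∀ {x y} → y ≤∞ x → min∞ x y ≡ y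
  min∞-≥ (fin≤fin p)          = cong fin (ℚ.p≥q⇒p⊓q≡q p)
  min∞-≥ {y = fin b} ≤+∞      = refl
  min∞-≥ {y = +∞}    ≤+∞      = refl

  -- Values of min-max-average terms: ℚ ∪ {+∞} with a least element ⊥₋ standing for −∞.
  ℚ̄ : Set
  ℚ̄ = ℚ∞ ₋

  open AddInfimum _≤∞_ public using (⊥₋≤_; [_]; [≤]-injective) renaming (_≤₋_ to _≤̄_)

  ≤̄-isTotalOrder : IsTotalOrder _≡_ _≤̄_
  ≤̄-isTotalOrder = AddInfimum.≤₋-isTotalOrder-≡ _≤∞_ ≤∞-isTotalOrder

  ≤̄-totalPreorder : TotalPreorder _ _ _
  ≤̄-totalPreorder = TotalOrder.totalPreorder (record { isTotalOrder = ≤̄-isTotalOrder })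

  open IsTotalOrder ≤̄-isTotalOrder public using () renaming (refl to ≤̄-refl; reflexive to ≤̄-reflexive; antisym to ≤̄-antisym)

  ≤̄-+∞ : ∀ x → x ≤̄ [ +∞ ]
  ≤̄-+∞ ⊥₋    = ⊥₋≤ _
  ≤̄-+∞ [ a ] = [ ≤+∞ ]

  infixl 6 _⊔̄_
  infixl 7 _⊓̄_

  _⊔̄_ : ℚ̄ → ℚ̄ → ℚ̄
  ⊥₋    ⊔̄ y     = y
  [ a ] ⊔̄ ⊥₋    = [ a ]
  [ a ] ⊔̄ [ b ] = [ max∞ a b ]

  _⊓̄_ : ℚ̄ → ℚ̄ → ℚ̄
  ⊥₋    ⊓̄ y     = ⊥₋
  [ a ] ⊓̄ ⊥₋    = ⊥₋
  [ a ] ⊓̄ [ b ] = [ min∞ a b ]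

  ⊔̄-operator : MaxOperator ≤̄-totalPreorder
  ⊔̄-operator = record
    { _⊔_       = _⊔̄_
    ; x≤y⇒x⊔y≈y = λ { (⊥₋≤ y) → refl ; [ p ] → cong [_] (max∞-≤ p) }
    ; x≥y⇒x⊔y≈x = λ { (⊥₋≤ ⊥₋) → refl ; (⊥₋≤ [ a ]) → refl ; [ p ] → cong [_] (max∞-≥ p) }
    }

  ⊓̄-operator : MinOperator ≤̄-totalPreorder
  ⊓̄-operator = record
    { _⊓_       = _⊓̄_
    ; x≤y⇒x⊓y≈x = λ { (⊥₋≤ y) → refl ; [ p ] → cong [_] (min∞-≤ p) }
    ; x≥y⇒x⊓y≈y = λ { (⊥₋≤ ⊥₋) → refl ; (⊥₋≤ [ a ]) → refl ; [ p ] → cong [_] (min∞-≥ p) }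
    }

  open MaxOp ⊔̄-operator public
    using () renaming (⊔-sel to ⊔̄-sel; ⊔-mono-≤ to ⊔̄-mono-≤; x≤x⊔y to x≤̄x⊔̄y; x≤y⊔x to y≤̄x⊔̄y; mono-≤-distrib-⊔ to mono-distrib-⊔̄)
  open MinOp ⊓̄-operator public
    using () renaming (⊓-zeroʳ to ⊓̄-zeroʳ; ⊓-sel to ⊓̄-sel; ⊓-mono-≤ to ⊓̄-mono-≤; x⊓y≤x to x⊓̄y≤̄x; x⊓y≤y to x⊓̄y≤̄y; mono-≤-distrib-⊓ to mono-distrib-⊓̄)

  map-mono : ∀ {h : ℚ∞ → ℚ∞} → (∀ {x y} → x ≤∞ y → h x ≤∞ h y) →
             ∀ {x y} → x ≤̄ y → map h x ≤̄ map h y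
  map-mono h-mono (⊥₋≤ y) = ⊥₋≤ map _ y
  map-mono h-mono [ p ]   = [ h-mono p ]

  infix 4 _≺_

  _≺_ : ℚ → ℚ̄ → Set
  q ≺ ⊥₋    = ⊥
  q ≺ [ y ] = fin q <∞ y

  ≺-≤̄-trans : ∀ {q x y} → q ≺ x → x ≤̄ y → q ≺ y
  ≺-≤̄-trans q≺x [ x≤y ] = <∞-≤∞-trans q≺x x≤y

  ≺⊎≥ : ∀ q x → q ≺ x ⊎ x ≤̄ [ fin q ]
  ≺⊎≥ q ⊥₋    = inj₂ (⊥₋≤ _)
  ≺⊎≥ q [ y ] with fin<∞⊎≥ q y
  ... | inj₁ q<y = inj₁ q<y
  ... | inj₂ y≤q = inj₂ [ y≤q ]

  ≺⇒≱ : ∀ {q x} → q ≺ x → ¬ (x ≤̄ [ fin q ])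
  ≺⇒≱ {x = [ y ]} q<y [ y≤q ] = <∞⇒≱∞ q<y y≤q

  ≺-shift : ∀ {q} t {x} → q ≺ x → q + t ≺ map (_+ᶜ t) x
  ≺-shift t {[ fin b ]} (fin<fin q<b) = fin<fin (ℚ.+-monoˡ-< t q<b)
  ≺-shift t {[ +∞ ]}    fin<∞         = fin<∞

  ≺-⊔̄⇔ : ∀ {q} x y → q ≺ x ⊔̄ y ⇔ (q ≺ x ⊎ q ≺ y)
  ≺-⊔̄⇔ {q} x y = mk⇔ to
    [ (λ q≺x → ≺-≤̄-trans q≺x (x≤̄x⊔̄y x y)) , (λ q≺y → ≺-≤̄-trans q≺y (y≤̄x⊔̄y x y)) ]′
    where
    to : q ≺ x ⊔̄ y → q ≺ x ⊎ q ≺ y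
    to q≺x⊔y with ⊔̄-sel x y
    ... | inj₁ eq = inj₁ (subst (q ≺_) eq q≺x⊔y)
    ... | inj₂ eq = inj₂ (subst (q ≺_) eq q≺x⊔y)

  ≺-⊓̄⇔ : ∀ {q} x y → q ≺ x ⊓̄ y ⇔ (q ≺ x × q ≺ y)
  ≺-⊓̄⇔ {q} x y = mk⇔
    (λ q≺x⊓y → ≺-≤̄-trans q≺x⊓y (x⊓̄y≤̄x x y) , ≺-≤̄-trans q≺x⊓y (x⊓̄y≤̄y x y)) from
    where
    from : q ≺ x × q ≺ y → q ≺ x ⊓̄ y
    from (q≺x , q≺y) with ⊓̄-sel x y
    ... | inj₁ eq = subst (q ≺_) (sym eq) q≺x
    ... | inj₂ eq = subst (q ≺_) (sym eq) q≺y


module LinearForms where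

  open Rationals
  open ExtendedRationals
  open import Data.Product using (proj₁; proj₂)
  open import Data.Rational using (ℚ; 0ℚ; 1ℚ; _+_; _*_; _≤_; _<_; nonNegative)
  import Data.Rational.Properties as ℚ
  open import Data.Nat using (ℕ; zero; suc)
  open import Data.Fin using (Fin; zero; suc)
  open import Data.Vec.Functional using (tail)
  open import Function using (_∘_)
  open import Algebra.Bundles using (Ring)
  open import Relation.Binary.PropositionalEquality
  open ≡-Reasoning
  import Algebra.Properties.Semiring.Sum (Ring.semiring ℚ.+-*-ring) as ℚ-Sum
  import Algebra.Properties.CommutativeMonoid.Sum ⊕-commutativeMonoid as ℚ∞-Sum

  private
    variable
      n : ℕ

  ∑ : (Fin n → ℚ) → ℚ
  ∑ = ℚ-Sum.sum

  lin : (Fin n → ℚ) → (Fin n → ℚ∞) → ℚ∞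
  lin c v = ℚ∞-Sum.sum (λ j → c j ⊙ v j)

  NonNeg : (Fin n → ℚ) → Set
  NonNeg c = ∀ j → 0ℚ ≤ c j

  *-nonNeg : ∀ {a b} → 0ℚ ≤ a → 0ℚ ≤ b → 0ℚ ≤ a * b
  *-nonNeg {a} {b} 0≤a 0≤b = ℚ.nonNegative⁻¹ (a * b) {{ℚ.nonNeg*nonNeg⇒nonNeg a {{nonNegative 0≤a}} b {{nonNegative 0≤b}}}}

  ∑-nonNeg : ∀ (c : Fin n → ℚ) → NonNeg c → 0ℚ ≤ ∑ c
  ∑-nonNeg {zero}  c c≥0 = ℚ.≤-refl
  ∑-nonNeg {suc n} c c≥0 = ℚ.+-mono-≤ (c≥0 zero) (∑-nonNeg (tail c) (c≥0 ∘ suc))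

  ∑-distrib-+ : ∀ (c d : Fin n → ℚ) → ∑ (λ j → c j + d j) ≡ ∑ c + ∑ d
  ∑-distrib-+ = ℚ-Sum.∑-distrib-+

  ∑-scale : ∀ a (c : Fin n → ℚ) → ∑ (λ j → a * c j) ≡ a * ∑ c
  ∑-scale a c = sym (ℚ-Sum.*-distribˡ-sum a c)

  ∑-shift : ∀ (c x : Fin n → ℚ) s → ∑ (λ j → c j * (x j + s)) ≡ ∑ (λ j → c j * x j) + ∑ c * s
  ∑-shift c x s = begin
    ∑ (λ j → c j * (x j + s))               ≡⟨ ℚ-Sum.sum-cong-≗ (λ j → ℚ.*-distribˡ-+ (c j) (x j) s) ⟩
    ∑ (λ j → c j * x j + c j * s)           ≡⟨ ∑-distrib-+ (λ j → c j * x j) (λ j → c j * s) ⟩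
    ∑ (λ j → c j * x j) + ∑ (λ j → c j * s) ≡⟨ cong (∑ (λ j → c j * x j) +_) (ℚ-Sum.*-distribʳ-sum s c) ⟨
    ∑ (λ j → c j * x j) + ∑ c * s            ∎

  lin-mono : ∀ (c : Fin n → ℚ) → NonNeg c → ∀ {v w} → (∀ j → v j ≤∞ w j) → lin c v ≤∞ lin c w
  lin-mono {zero}  c c≥0 v≤w = ≤∞-refl
  lin-mono {suc n} c c≥0 v≤w = ⊕-mono (⊙-mono (c≥0 zero) (v≤w zero)) (lin-mono (tail c) (c≥0 ∘ suc) (v≤w ∘ suc))

  lin-distrib-+ : ∀ (c d : Fin n → ℚ) → NonNeg c → NonNeg d → ∀ v →
                  lin (λ j → c j + d j) v ≡ lin c v ⊕ lin d v
  lin-distrib-+ c d c≥0 d≥0 v = trans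
    (ℚ∞-Sum.sum-cong-≗ (λ j → ⊙-distribʳ-+ (c≥0 j) (d≥0 j) (v j)))
    (ℚ∞-Sum.∑-distrib-+ (λ j → c j ⊙ v j) (λ j → d j ⊙ v j))

  lin-scale : ∀ {a} → 0ℚ < a → ∀ (c : Fin n → ℚ) → NonNeg c → ∀ v → lin (λ j → a * c j) v ≡ a · lin c v
  lin-scale {zero}  {a} 0<a c c≥0 v = cong fin (sym (ℚ.*-zeroʳ a))
  lin-scale {suc n} {a} 0<a c c≥0 v = begin
    (a * c zero) ⊙ v zero ⊕ lin (λ j → a * c (suc j)) (tail v)
      ≡⟨ cong₂ _⊕_ (⊙-assoc 0<a (c≥0 zero) (v zero)) (lin-scale 0<a (tail c) (c≥0 ∘ suc) (tail v)) ⟩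
    (a · (c zero ⊙ v zero)) ⊕ (a · lin (tail c) (tail v))       ≡⟨ ·-distrib-⊕ a _ _ ⟨
    a · lin c v                                                ∎

  lin-fin : ∀ (c x : Fin n → ℚ) → lin c (fin ∘ x) ≡ fin (∑ λ j → c j * x j)
  lin-fin {zero}  c x = refl
  lin-fin {suc n} c x = cong (fin (c zero * x zero) ⊕_) (lin-fin (tail c) (tail x))

  lin-0 : ∀ (v : Fin n → ℚ∞) → lin (λ _ → 0ℚ) v ≡ fin 0ℚ
  lin-0 {zero}  v = refl
  lin-0 {suc n} v = trans (cong₂ _⊕_ (0⊙ (v zero)) (lin-0 (tail v))) (⊕-identityˡ (fin 0ℚ))

  lin-zero : ∀ (c : Fin n → ℚ) → NonNeg c → ∑ c ≡ 0ℚ → ∀ v → lin c v ≡ fin 0ℚ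
  lin-zero {zero}  c c≥0 ∑c≡0 v = refl
  lin-zero {suc n} c c≥0 ∑c≡0 v = begin
    c zero ⊙ v zero ⊕ lin (tail c) (tail v)
      ≡⟨ cong₂ _⊕_ (cong (_⊙ v zero) c₀≡0) (lin-zero (tail c) (c≥0 ∘ suc) ∑tail≡0 (tail v)) ⟩
    0ℚ ⊙ v zero ⊕ fin 0ℚ
      ≡⟨ cong (_⊕ fin 0ℚ) (0⊙ (v zero)) ⟩
    fin 0ℚ
      ∎
    where
    c₀≡0 = proj₁ (nonNeg+nonNeg≡0 (c≥0 zero) (∑-nonNeg (tail c) (c≥0 ∘ suc)) ∑c≡0)
    ∑tail≡0 = proj₂ (nonNeg+nonNeg≡0 (c≥0 zero) (∑-nonNeg (tail c) (c≥0 ∘ suc)) ∑c≡0)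

  δ : Fin n → Fin n → ℚ
  δ zero    zero    = 1ℚ
  δ zero    (suc i) = 0ℚ
  δ (suc j) zero    = 0ℚ
  δ (suc j) (suc i) = δ j i

  δ-nonNeg : ∀ (j : Fin n) → NonNeg (δ j)
  δ-nonNeg zero    zero    = ℚ.<⇒≤ (ℚ.positive⁻¹ 1ℚ)
  δ-nonNeg zero    (suc i) = ℚ.≤-refl
  δ-nonNeg (suc j) zero    = ℚ.≤-refl
  δ-nonNeg (suc j) (suc i) = δ-nonNeg j i

  ∑-δ : ∀ (j : Fin n) → ∑ (δ j) ≡ 1ℚ
  ∑-δ {suc n} zero    = cong (1ℚ +_) (ℚ-Sum.sum-replicate-zero n)
  ∑-δ {suc n} (suc j) = trans (ℚ.+-identityˡ _) (∑-δ j)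

  lin-δ : ∀ (j : Fin n) v → lin (δ j) v ≡ v j
  lin-δ {suc n} zero    v = trans (cong₂ _⊕_ (1⊙ (v zero)) (lin-0 (tail v))) (⊕-identityʳ (v zero))
  lin-δ {suc n} (suc j) v = trans (cong₂ _⊕_ (0⊙ (v zero)) (lin-δ j (tail v))) (⊕-identityˡ (v (suc j)))

module Terms where

  open ExtendedRationals
  open Values
  open LinearForms
  open import Data.Rational using (ℚ; 1ℚ; _+_; _*_)
  open import Data.Rational.Solver using (module +-*-Solver)
  open import Data.Nat using (ℕ; zero; suc)
  open import Data.Fin using (Fin; zero; suc)
  open import Data.Vec.Functional using (_∷_)
  open import Data.Maybe using (map)
  open import Function using (_∘_)
  open import Relation.Binary.PropositionalEquality
  open ≡-Reasoning
  open +-*-Solver using (solve; _:+_; _:*_; con; _:=_)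

  private
    variable
      n : ℕ

  record Affine (n : ℕ) : Set where
    field
      coef        : Fin n → ℚ
      coef-nonNeg : NonNeg coef
      coef-sum    : ∑ coef ≡ 1ℚ
      const       : ℚ

  open Affine public

  ⟦_⟧ᵃ : Affine n → (Fin n → ℚ∞) → ℚ∞
  ⟦ a ⟧ᵃ v = lin (coef a) v +ᶜ const a

  infixl 6 _∨_
  infixl 7 _∧_

  data Term (n : ℕ) : Set where
    aff     : Affine n → Term n
    top bot : Term n
    _∨_ _∧_ : Term n → Term n → Term n

  ⟦_⟧ : Term n → (Fin n → ℚ∞) → ℚ̄
  ⟦ aff a ⟧ v = [ ⟦ a ⟧ᵃ v ]
  ⟦ top   ⟧ v = [ +∞ ]
  ⟦ bot   ⟧ v = ⊥₋
  ⟦ s ∨ t ⟧ v = ⟦ s ⟧ v ⊔̄ ⟦ t ⟧ v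
  ⟦ s ∧ t ⟧ v = ⟦ s ⟧ v ⊓̄ ⟦ t ⟧ v

  infix 4 _≤ᵛ_

  _≤ᵛ_ : (v w : Fin n → ℚ∞) → Set
  v ≤ᵛ w = ∀ j → v j ≤∞ w j

  ∷-mono : ∀ {u u′} → u ≤∞ u′ → (y : Fin n → ℚ∞) → (u ∷ y) ≤ᵛ (u′ ∷ y)
  ∷-mono u≤u′ y zero    = u≤u′
  ∷-mono u≤u′ y (suc j) = ≤∞-refl

  ⟦⟧ᵃ-mono : ∀ (a : Affine n) {v w} → v ≤ᵛ w → ⟦ a ⟧ᵃ v ≤∞ ⟦ a ⟧ᵃ w
  ⟦⟧ᵃ-mono a v≤w = +ᶜ-mono (const a) (lin-mono (coef a) (coef-nonNeg a) v≤w)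

  ⟦⟧-mono : ∀ (t : Term n) {v w} → v ≤ᵛ w → ⟦ t ⟧ v ≤̄ ⟦ t ⟧ w
  ⟦⟧-mono (aff a) v≤w = [ ⟦⟧ᵃ-mono a v≤w ]
  ⟦⟧-mono top     v≤w = ≤̄-refl
  ⟦⟧-mono bot     v≤w = ⊥₋≤ _
  ⟦⟧-mono (s ∨ t) v≤w = ⊔̄-mono-≤ (⟦⟧-mono s v≤w) (⟦⟧-mono t v≤w)
  ⟦⟧-mono (s ∧ t) v≤w = ⊓̄-mono-≤ (⟦⟧-mono s v≤w) (⟦⟧-mono t v≤w)

  ⟦⟧-cong : ∀ (t : Term n) {v w} → (∀ j → v j ≡ w j) → ⟦ t ⟧ v ≡ ⟦ t ⟧ w
  ⟦⟧-cong t v≗w = ≤̄-antisym (⟦⟧-mono t (≤∞-reflexive ∘ v≗w)) (⟦⟧-mono t (≤∞-reflexive ∘ sym ∘ v≗w))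

  ⟦⟧≡⊥₋ : ∀ (t : Term n) {v} w → ⟦ t ⟧ v ≡ ⊥₋ → ⟦ t ⟧ w ≡ ⊥₋
  ⟦⟧≡⊥₋ (aff a) w ()
  ⟦⟧≡⊥₋ top     w ()
  ⟦⟧≡⊥₋ bot     w _ = refl
  ⟦⟧≡⊥₋ (s ∨ t) {v} w with ⟦ s ⟧ v in s≡ | ⟦ t ⟧ v in t≡
  ... | ⊥₋    | ⊥₋    = λ _ → cong₂ _⊔̄_ (⟦⟧≡⊥₋ s w s≡) (⟦⟧≡⊥₋ t w t≡)
  ... | ⊥₋    | [ _ ] = λ ()
  ... | [ _ ] | ⊥₋    = λ ()
  ... | [ _ ] | [ _ ] = λ ()
  ⟦⟧≡⊥₋ (s ∧ t) {v} w with ⟦ s ⟧ v in s≡ | ⟦ t ⟧ v in t≡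
  ... | ⊥₋    | _     = λ _ → cong (_⊓̄ ⟦ t ⟧ w) (⟦⟧≡⊥₋ s w s≡)
  ... | [ _ ] | ⊥₋    = λ _ → trans (cong (⟦ s ⟧ w ⊓̄_) (⟦⟧≡⊥₋ t w t≡)) (⊓̄-zeroʳ ⊥₋≤_ (⟦ s ⟧ w))
  ... | [ _ ] | [ _ ] = λ ()

  ⟦⟧ᵃ-shift : ∀ (a : Affine n) x s → ⟦ a ⟧ᵃ (λ j → fin (x j + s)) ≡ ⟦ a ⟧ᵃ (fin ∘ x) +ᶜ s
  ⟦⟧ᵃ-shift a x s = begin
    lin c (λ j → fin (x j + s)) +ᶜ k    ≡⟨ cong (_+ᶜ k) (lin-fin c (λ j → x j + s)) ⟩
    fin (∑ (λ j → c j * (x j + s)) + k) ≡⟨ cong (λ u → fin (u + k)) (∑-shift c x s) ⟩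
    fin (cx + ∑ c * s + k)              ≡⟨ cong (λ u → fin (cx + u * s + k)) (coef-sum a) ⟩
    fin (cx + 1ℚ * s + k)               ≡⟨ cong fin (solve 3 (λ cx s k → cx :+ con 1ℚ :* s :+ k := cx :+ k :+ s)
                                                             refl cx s k) ⟩
    fin (cx + k + s)                    ≡⟨ cong (λ u → (u +ᶜ k) +ᶜ s) (lin-fin c x) ⟨
    ⟦ a ⟧ᵃ (fin ∘ x) +ᶜ s               ∎
    where
    c = coef a
    k = const a
    cx = ∑ (λ j → c j * x j)

  ⟦⟧-shift : ∀ (t : Term n) x s → ⟦ t ⟧ (λ j → fin (x j + s)) ≡ map (_+ᶜ s) (⟦ t ⟧ (fin ∘ x))
  ⟦⟧-shift (aff a) x s = cong [_] (⟦⟧ᵃ-shift a x s)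
  ⟦⟧-shift top     x s = refl
  ⟦⟧-shift bot     x s = refl
  ⟦⟧-shift (t ∨ u) x s = trans (cong₂ _⊔̄_ (⟦⟧-shift t x s) (⟦⟧-shift u x s))
    (sym (mono-distrib-⊔̄ (cong (map (_+ᶜ s))) (map-mono (+ᶜ-mono s)) (⟦ t ⟧ (fin ∘ x)) (⟦ u ⟧ (fin ∘ x))))
  ⟦⟧-shift (t ∧ u) x s = trans (cong₂ _⊓̄_ (⟦⟧-shift t x s) (⟦⟧-shift u x s))
    (sym (mono-distrib-⊓̄ (cong (map (_+ᶜ s))) (map-mono (+ᶜ-mono s)) (⟦ t ⟧ (fin ∘ x)) (⟦ u ⟧ (fin ∘ x))))

module Elimination where

  open Rationals
  open ExtendedRationals
  open Values
  open LinearForms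
  open Terms
  open import Data.Rational using (ℚ; 0ℚ; 1ℚ; _+_; _*_; _-_; -_; _≤_; _<_)
  import Data.Rational.Properties as ℚ
  open import Data.Rational.Solver using (module +-*-Solver)
  open import Data.Nat using (ℕ; zero; suc)
  open import Data.Fin using (Fin; zero; suc)
  open import Data.Vec.Functional using (_∷_; tail)
  open import Data.Maybe using (map)
  open import Data.Product using (_,_; proj₁; proj₂; map₂)
  open import Data.Sum using (inj₁; inj₂)
  open import Data.Empty using (⊥-elim)
  open import Function using (_∘_; _⇔_; mk⇔; Equivalence)
  import Function.Properties.Equivalence as ⇔
  open import Data.Sum.Function.Propositional using (_⊎-⇔_)
  open import Data.Product.Function.NonDependent.Propositional using (_×-⇔_)
  open import Relation.Binary.PropositionalEquality
  open ≡-Reasoning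
  open import Relation.Nullary using (yes; no)
  open +-*-Solver using (solve; _:+_; _:*_; _:-_; con; _:=_)

  private
    variable
      n : ℕ

  ∑-tail : ∀ (a : Affine (suc n)) → ∑ (tail (coef a)) ≡ 1ℚ - coef a zero
  ∑-tail a = trans (solve 2 (λ c t → t := c :+ t :- c) refl (coef a zero) (∑ (tail (coef a))))
                   (cong (_- coef a zero) (coef-sum a))

  coef₀≤1 : ∀ (a : Affine (suc n)) → coef a zero ≤ 1ℚ
  coef₀≤1 a = subst (coef a zero ≤_) (coef-sum a)
    (subst (_≤ ∑ (coef a)) (ℚ.+-identityʳ (coef a zero))
      (ℚ.+-monoʳ-≤ (coef a zero) (∑-nonNeg (tail (coef a)) (coef-nonNeg a ∘ suc))))

  ⟦⟧ᵃ-coef₀≡1 : ∀ (a : Affine (suc n)) → coef a zero ≡ 1ℚ → ∀ z y → ⟦ a ⟧ᵃ (fin z ∷ y) ≡ fin (z + const a)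
  ⟦⟧ᵃ-coef₀≡1 a c₀≡1 z y = begin
    (fin (coef a zero * z) ⊕ lin (tail (coef a)) y) +ᶜ const a
      ≡⟨ cong₂ (λ c L → (fin (c * z) ⊕ L) +ᶜ const a) c₀≡1 tail≡0 ⟩
    fin (1ℚ * z + 0ℚ + const a)
      ≡⟨ cong fin (solve 2 (λ z k → con 1ℚ :* z :+ con 0ℚ :+ k := z :+ k) refl z (const a)) ⟩
    fin (z + const a)
      ∎
    where
    tail≡0 : lin (tail (coef a)) y ≡ fin 0ℚ
    tail≡0 = lin-zero (tail (coef a)) (coef-nonNeg a ∘ suc)
      (trans (∑-tail a) (trans (cong (λ c → 1ℚ - c) c₀≡1) (ℚ.+-inverseʳ 1ℚ))) y

  <⟦⟧ᵃ⇔0<const : ∀ (a : Affine (suc n)) → coef a zero ≡ 1ℚ → ∀ z y → fin z <∞ ⟦ a ⟧ᵃ (fin z ∷ y) ⇔ 0ℚ < const a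
  <⟦⟧ᵃ⇔0<const a c₀≡1 z y = subst (λ u → fin z <∞ u ⇔ 0ℚ < const a) (sym (⟦⟧ᵃ-coef₀≡1 a c₀≡1 z y))
    (⇔.trans fin<fin⇔ (x<x+k⇔0<k z (const a)))

  -- For c₀ = coef a zero < 1, the condition z < c₀ z + L + k on x₀ = z solves to z < (L + k)/(1 − c₀).
  module Solve₀ (a : Affine (suc n)) (c₀≢1 : coef a zero ≢ 1ℚ) where

    private
      c₀ = coef a zero
      0<d : 0ℚ < 1ℚ - c₀
      0<d = subst (_< 1ℚ - c₀) (ℚ.+-inverseʳ c₀) (ℚ.+-monoˡ-< (- c₀) (≤∧≢⇒< (coef₀≤1 a) c₀≢1))
      s   = proj₁ (pos-inverse 0<d)
      ds≡1 = proj₁ (proj₂ (pos-inverse 0<d))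
      0<s = proj₂ (proj₂ (pos-inverse 0<d))

    affine : Affine n
    affine = record
      { coef        = λ j → s * coef a (suc j)
      ; coef-nonNeg = λ j → *-nonNeg (ℚ.<⇒≤ 0<s) (coef-nonNeg a (suc j))
      ; coef-sum    = trans (∑-scale s (tail (coef a))) (trans (cong (s *_) (∑-tail a)) (trans (ℚ.*-comm s _) ds≡1))
      ; const       = s * const a
      }

    spec : ∀ z y → fin z <∞ ⟦ a ⟧ᵃ (fin z ∷ y) ⇔ fin z <∞ ⟦ affine ⟧ᵃ y
    spec z y = subst₂ (λ u w → fin z <∞ u ⇔ fin z <∞ w)
      (sym (⊕-+ᶜ (fin (c₀ * z)) L (const a)))
      (trans (·-distrib-+ᶜ s L (const a))
             (cong (_+ᶜ (s * const a)) (sym (lin-scale 0<s (tail (coef a)) (coef-nonNeg a ∘ suc) y))))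
      (x<c*x+M⇔x<s·M {c₀} ds≡1 0<d 0<s z (L +ᶜ const a))
      where L = lin (tail (coef a)) y

  thresholdᵃ : Affine (suc n) → Term n
  thresholdᵃ a with coef a zero ℚ.≟ 1ℚ | 0ℚ ℚ.<? const a
  ... | yes _    | yes _ = top
  ... | yes _    | no  _ = bot
  ... | no c₀≢1 | _     = aff (Solve₀.affine a c₀≢1)

  thresholdᵃ-spec : ∀ (a : Affine (suc n)) z y → fin z <∞ ⟦ a ⟧ᵃ (fin z ∷ y) ⇔ z ≺ ⟦ thresholdᵃ a ⟧ y
  thresholdᵃ-spec a z y with coef a zero ℚ.≟ 1ℚ | 0ℚ ℚ.<? const a
  ... | yes c₀≡1 | yes 0<k = mk⇔ (λ _ → fin<∞) (λ _ → Equivalence.from (<⟦⟧ᵃ⇔0<const a c₀≡1 z y) 0<k)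
  ... | yes c₀≡1 | no  0≮k = mk⇔ (λ z<v → 0≮k (Equivalence.to (<⟦⟧ᵃ⇔0<const a c₀≡1 z y) z<v)) (λ ())
  ... | no c₀≢1 | _       = Solve₀.spec a c₀≢1 z y

  threshold : Term (suc n) → Term n
  threshold (aff a) = thresholdᵃ a
  threshold top     = top
  threshold bot     = bot
  threshold (s ∨ t) = threshold s ∨ threshold t
  threshold (s ∧ t) = threshold s ∧ threshold t

  threshold-spec : ∀ (t : Term (suc n)) z y → z ≺ ⟦ t ⟧ (fin z ∷ y) ⇔ z ≺ ⟦ threshold t ⟧ y
  threshold-spec (aff a) z y = thresholdᵃ-spec a z y
  threshold-spec top     z y = ⇔.refl
  threshold-spec bot     z y = ⇔.refl
  threshold-spec (s ∨ t) z y = ⇔.trans (≺-⊔̄⇔ _ _)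
    (⇔.trans (threshold-spec s z y ⊎-⇔ threshold-spec t z y) (⇔.sym (≺-⊔̄⇔ _ _)))
  threshold-spec (s ∧ t) z y = ⇔.trans (≺-⊓̄⇔ _ _)
    (⇔.trans (threshold-spec s z y ×-⇔ threshold-spec t z y) (⇔.sym (≺-⊓̄⇔ _ _)))

  threshold-super : ∀ (t : Term (suc n)) z y → ⟦ threshold t ⟧ y ≤̄ [ fin z ] → ⟦ t ⟧ (fin z ∷ y) ≤̄ [ fin z ]
  threshold-super t z y g≤z with ≺⊎≥ z (⟦ t ⟧ (fin z ∷ y))
  ... | inj₁ z≺t = ⊥-elim (≺⇒≱ (Equivalence.to (threshold-spec t z y) z≺t) g≤z)
  ... | inj₂ t≤z = t≤z

  dropᵃ : ∀ (a : Affine (suc n)) → coef a zero ≡ 0ℚ → Affine n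
  dropᵃ a c₀≡0 = record
    { coef        = tail (coef a)
    ; coef-nonNeg = coef-nonNeg a ∘ suc
    ; coef-sum    = trans (∑-tail a) (trans (cong (λ c → 1ℚ - c) c₀≡0) (ℚ.+-identityʳ 1ℚ))
    ; const       = const a
    }

  ⟦dropᵃ⟧ : ∀ (a : Affine (suc n)) (c₀≡0 : coef a zero ≡ 0ℚ) u y → ⟦ a ⟧ᵃ (u ∷ y) ≡ ⟦ dropᵃ a c₀≡0 ⟧ᵃ y
  ⟦dropᵃ⟧ a c₀≡0 u y = cong (_+ᶜ const a) (begin
    coef a zero ⊙ u ⊕ lin (tail (coef a)) y  ≡⟨ cong (λ c → c ⊙ u ⊕ lin (tail (coef a)) y) c₀≡0 ⟩
    0ℚ ⊙ u ⊕ lin (tail (coef a)) y           ≡⟨ cong (_⊕ lin (tail (coef a)) y) (0⊙ u) ⟩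
    fin 0ℚ ⊕ lin (tail (coef a)) y           ≡⟨ ⊕-identityˡ _ ⟩
    lin (tail (coef a)) y                    ∎)

  composeᵃ : Affine (suc n) → Affine n → Affine n
  composeᵃ a b = record
    { coef        = λ j → coef a (suc j) + c₀ * coef b j
    ; coef-nonNeg = λ j → ℚ.+-mono-≤ (coef-nonNeg a (suc j)) (*-nonNeg (coef-nonNeg a zero) (coef-nonNeg b j))
    ; coef-sum    = begin
        ∑ (λ j → coef a (suc j) + c₀ * coef b j)
          ≡⟨ ∑-distrib-+ (tail (coef a)) (λ j → c₀ * coef b j) ⟩
        ∑ (tail (coef a)) + ∑ (λ j → c₀ * coef b j)
          ≡⟨ cong₂ _+_ (∑-tail a) (trans (∑-scale c₀ (coef b)) (cong (c₀ *_) (coef-sum b))) ⟩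
        (1ℚ - c₀) + c₀ * 1ℚ
          ≡⟨ solve 1 (λ c → (con 1ℚ :- c) :+ c :* con 1ℚ := con 1ℚ) refl c₀ ⟩
        1ℚ
          ∎
    ; const       = const a + c₀ * const b
    }
    where c₀ = coef a zero

  ⟦composeᵃ⟧ : ∀ (a : Affine (suc n)) → 0ℚ < coef a zero → ∀ b y → ⟦ composeᵃ a b ⟧ᵃ y ≡ ⟦ a ⟧ᵃ (⟦ b ⟧ᵃ y ∷ y)
  ⟦composeᵃ⟧ a 0<c₀ b y = begin
    lin (λ j → coef a (suc j) + c₀ * coef b j) y +ᶜ (const a + c₀ * const b)
      ≡⟨ cong (_+ᶜ (const a + c₀ * const b))
              (lin-distrib-+ (tail (coef a)) (λ j → c₀ * coef b j) (coef-nonNeg a ∘ suc) c₀b≥0 y) ⟩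
    (L ⊕ lin (λ j → c₀ * coef b j) y) +ᶜ (const a + c₀ * const b)
      ≡⟨ cong (λ e → (L ⊕ e) +ᶜ (const a + c₀ * const b)) (lin-scale 0<c₀ (coef b) (coef-nonNeg b) y) ⟩
    (L ⊕ (c₀ · lin (coef b) y)) +ᶜ (const a + c₀ * const b)
      ≡⟨ ⊕-+ᶜ-swap L (c₀ · lin (coef b) y) (const a) (c₀ * const b) ⟩
    (((c₀ · lin (coef b) y) +ᶜ (c₀ * const b)) ⊕ L) +ᶜ const a
      ≡⟨ cong (λ e → (e ⊕ L) +ᶜ const a)
              (trans (sym (·-distrib-+ᶜ c₀ (lin (coef b) y) (const b))) (sym (pos⊙ 0<c₀ (⟦ b ⟧ᵃ y)))) ⟩
    ⟦ a ⟧ᵃ (⟦ b ⟧ᵃ y ∷ y)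
      ∎
    where
    c₀ = coef a zero
    L  = lin (tail (coef a)) y
    c₀b≥0 = λ j → *-nonNeg (coef-nonNeg a zero) (coef-nonNeg b j)

  -- a with x₀ := g; only meaningful for coef a zero > 0, since x₀ = +∞ with weight 0 contributes 0.
  plug : Affine (suc n) → Term n → Term n
  plug a (aff b) = aff (composeᵃ a b)
  plug a top     = top
  plug a bot     = bot
  plug a (g ∨ h) = plug a g ∨ plug a h
  plug a (g ∧ h) = plug a g ∧ plug a h

  ⟦plug⟧ : ∀ (a : Affine (suc n)) → 0ℚ < coef a zero → ∀ g y → ⟦ plug a g ⟧ y ≡ map (λ u → ⟦ a ⟧ᵃ (u ∷ y)) (⟦ g ⟧ y)
  ⟦plug⟧ a 0<c₀ (aff b) y = cong [_] (⟦composeᵃ⟧ a 0<c₀ b y)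
  ⟦plug⟧ a 0<c₀ top     y = cong (λ e → [ (e ⊕ lin (tail (coef a)) y) +ᶜ const a ]) (sym (pos⊙ 0<c₀ +∞))
  ⟦plug⟧ a 0<c₀ bot     y = refl
  ⟦plug⟧ a 0<c₀ (g ∨ h) y = trans (cong₂ _⊔̄_ (⟦plug⟧ a 0<c₀ g y) (⟦plug⟧ a 0<c₀ h y))
    (sym (mono-distrib-⊔̄ (cong (map _)) (map-mono λ u≤u′ → ⟦⟧ᵃ-mono a (∷-mono u≤u′ y)) (⟦ g ⟧ y) (⟦ h ⟧ y)))
  ⟦plug⟧ a 0<c₀ (g ∧ h) y = trans (cong₂ _⊓̄_ (⟦plug⟧ a 0<c₀ g y) (⟦plug⟧ a 0<c₀ h y))
    (sym (mono-distrib-⊓̄ (cong (map _)) (map-mono λ u≤u′ → ⟦⟧ᵃ-mono a (∷-mono u≤u′ y)) (⟦ g ⟧ y) (⟦ h ⟧ y)))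

  substitute : Term (suc n) → Term n → Term n
  substitute (aff a) g with nonNeg-split (coef-nonNeg a zero)
  ... | inj₁ c₀≡0 = aff (dropᵃ a c₀≡0)
  ... | inj₂ 0<c₀ = plug a g
  substitute top     g = top
  substitute bot     g = bot
  substitute (s ∨ t) g = substitute s g ∨ substitute t g
  substitute (s ∧ t) g = substitute s g ∧ substitute t g

  substitute-spec : ∀ (t : Term (suc n)) g y {u} → ⟦ g ⟧ y ≡ [ u ] → ⟦ substitute t g ⟧ y ≡ ⟦ t ⟧ (u ∷ y)
  substitute-spec (aff a) g y {u} g≡u with nonNeg-split (coef-nonNeg a zero)
  ... | inj₁ c₀≡0 = cong [_] (sym (⟦dropᵃ⟧ a c₀≡0 u y))
  ... | inj₂ 0<c₀ = trans (⟦plug⟧ a 0<c₀ g y) (cong (map _) g≡u)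
  substitute-spec top     g y g≡u = refl
  substitute-spec bot     g y g≡u = refl
  substitute-spec (s ∨ t) g y g≡u = cong₂ _⊔̄_ (substitute-spec s g y g≡u) (substitute-spec t g y g≡u)
  substitute-spec (s ∧ t) g y g≡u = cong₂ _⊓̄_ (substitute-spec s g y g≡u) (substitute-spec t g y g≡u)

  ≺⟦⟧-upClosed : ∀ (t : Term (suc n)) y q → UpClosed (λ z → q ≺ ⟦ t ⟧ (fin z ∷ y))
  ≺⟦⟧-upClosed t y q z≤z′ q≺t = ≺-≤̄-trans q≺t (⟦⟧-mono t (∷-mono (fin≤fin z≤z′) y))

  witness : ∀ (t : Term (suc n)) y {q} u → q ≺ ⟦ t ⟧ (u ∷ y) → Witness u (λ z → q ≺ ⟦ t ⟧ (fin z ∷ y))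
  witness (aff a) y {q} u q≺t with nonNeg-split (coef-nonNeg a zero)
  ... | inj₁ c₀≡0 = let z , z<u = fin-below u in
    z , z<u , subst (fin q <∞_) (trans (⟦dropᵃ⟧ a c₀≡0 u y) (sym (⟦dropᵃ⟧ a c₀≡0 (fin z) y))) q≺t
  ... | inj₂ 0<c₀ = ⊙-witness 0<c₀ (lin (tail (coef a)) y) (const a) u q≺t
  witness top     y u _   = let z , z<u = fin-below u in z , z<u , fin<∞
  witness bot     y u ()
  witness (s ∨ t) y u q≺t with Equivalence.to (≺-⊔̄⇔ (⟦ s ⟧ (u ∷ y)) _) q≺t
  ... | inj₁ q≺s = map₂ (map₂ (Equivalence.from (≺-⊔̄⇔ _ _) ∘ inj₁)) (witness s y u q≺s)
  ... | inj₂ q≺t′ = map₂ (map₂ (Equivalence.from (≺-⊔̄⇔ _ _) ∘ inj₂)) (witness t y u q≺t′)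
  witness (s ∧ t) y {q} u q≺t with Equivalence.to (≺-⊓̄⇔ (⟦ s ⟧ (u ∷ y)) _) q≺t
  ... | q≺s , q≺t′ = map₂ (map₂ (Equivalence.from (≺-⊓̄⇔ _ _)))
    (witness-× (≺⟦⟧-upClosed s y q) (≺⟦⟧-upClosed t y q) (witness s y u q≺s) (witness t y u q≺t′))

  witness-∀ : ∀ {m u} (Q : Fin m → ℚ → Set) → (∀ i → UpClosed (Q i)) → (∀ i → Witness u (Q i)) →
              Witness u (λ z → ∀ i → Q i z)
  witness-∀ {zero}  {u} Q Q↑ w = let z , z<u = fin-below u in z , z<u , λ ()
  witness-∀ {suc m}     Q Q↑ w
    with witness-× (Q↑ zero) (λ z≤z′ Qz i → Q↑ (suc i) z≤z′ (Qz i))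
                   (w zero) (witness-∀ (Q ∘ suc) (Q↑ ∘ suc) (w ∘ suc))
  ... | z , z<u , Q₀z , Qₛz = z , z<u , λ { zero → Q₀z ; (suc i) → Qₛz i }

module Alternative where

  open ExtendedRationals
  open Values
  open Terms
  open Elimination
  open import Data.Rational using (ℚ; 0ℚ; _+_; -_)
  import Data.Rational.Properties as ℚ
  open import Data.Nat using (ℕ; zero; suc)
  open import Data.Fin using (Fin; zero; suc)
  open import Data.Fin.Properties using (¬∀⟶∃¬)
  open import Data.Vec.Functional using (_∷_)
  open import Data.Product using (Σ-syntax; ∃-syntax; _×_; _,_; proj₁; proj₂)
  open import Data.Sum using (_⊎_; inj₁; inj₂)
  open import Data.Empty using (⊥)
  open import Data.List using (allFin)
  import Data.List.Relation.Unary.All as All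
  open import Data.List.Membership.Propositional.Properties using (∈-allFin)
  import Data.List.Extrema ≤∞-totalOrder as Extrema
  open import Function using (_∘_; Equivalence)
  open import Relation.Binary.PropositionalEquality
  open import Relation.Nullary using (¬_)

  private
    variable
      n : ℕ

  Subsolution : (Fin n → Term n) → Set
  Subsolution {n} f = Σ[ x ∈ (Fin n → ℚ) ] ∀ i → x i ≺ ⟦ f i ⟧ (fin ∘ x)

  Supersolution : (Fin n → Term n) → Set
  Supersolution {n} f = Σ[ y ∈ (Fin n → ℚ∞) ] ¬ (∀ i → y i ≡ +∞) × (∀ i → ⟦ f i ⟧ y ≤̄ [ y i ])

  module Step (f : Fin (suc n) → Term (suc n)) where

    g : Term n
    g = threshold (f zero)

    reduced : Fin n → Term n
    reduced i = substitute (f (suc i)) g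

    super-if-⊥ : ⟦ g ⟧ (λ _ → +∞) ≡ ⊥₋ → Supersolution f
    super-if-⊥ g≡⊥ = (fin 0ℚ ∷ λ _ → +∞) , (λ all+∞ → case₀ (all+∞ zero)) , super
      where
      case₀ : fin 0ℚ ≢ +∞
      case₀ ()
      super : ∀ i → ⟦ f i ⟧ (fin 0ℚ ∷ λ _ → +∞) ≤̄ [ (fin 0ℚ ∷ λ _ → +∞) i ]
      super zero    = threshold-super (f zero) 0ℚ _ (subst (_≤̄ [ fin 0ℚ ]) (sym g≡⊥) (⊥₋≤ _))
      super (suc i) = ≤̄-+∞ _

    extend-sub : Subsolution reduced → Subsolution f ⊎ Supersolution f
    extend-sub (x , x≺) with ⟦ g ⟧ (fin ∘ x) in g≡
    ... | ⊥₋    = inj₂ (super-if-⊥ (⟦⟧≡⊥₋ g _ g≡))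
    ... | [ u ] with witness-∀ (λ i z → x i ≺ ⟦ f (suc i) ⟧ (fin z ∷ fin ∘ x))
                               (λ i → ≺⟦⟧-upClosed (f (suc i)) (fin ∘ x) (x i))
                               (λ i → witness (f (suc i)) (fin ∘ x) u
                                        (subst (x i ≺_) (substitute-spec (f (suc i)) g (fin ∘ x) g≡) (x≺ i)))
    ...   | z , z<u , x≺f = inj₁ ((z ∷ x) , sub)
      where
      env≡ : ∀ j → (fin z ∷ fin ∘ x) j ≡ fin ((z ∷ x) j)
      env≡ zero    = refl
      env≡ (suc j) = refl
      sub : ∀ i → (z ∷ x) i ≺ ⟦ f i ⟧ (fin ∘ (z ∷ x))
      sub zero    = subst (z ≺_) (⟦⟧-cong (f zero) env≡)
        (Equivalence.from (threshold-spec (f zero) z (fin ∘ x)) (subst (z ≺_) (sym g≡) z<u))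
      sub (suc i) = subst (x i ≺_) (⟦⟧-cong (f (suc i)) env≡) (x≺f i)

    extend-super : Supersolution reduced → Supersolution f
    extend-super (y , y≢+∞ , y≥) with ⟦ g ⟧ y in g≡
    ... | ⊥₋    = super-if-⊥ (⟦⟧≡⊥₋ g _ g≡)
    ... | [ u ] = (u ∷ y) , (λ all+∞ → y≢+∞ (all+∞ ∘ suc)) , super
      where
      super₀ : ∀ u → ⟦ g ⟧ y ≡ [ u ] → ⟦ f zero ⟧ (u ∷ y) ≤̄ [ u ]
      super₀ (fin w) g≡w = threshold-super (f zero) w y (≤̄-reflexive g≡w)
      super₀ +∞      _   = ≤̄-+∞ _
      super : ∀ i → ⟦ f i ⟧ (u ∷ y) ≤̄ [ (u ∷ y) i ]
      super zero    = super₀ u g≡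
      super (suc i) = subst (_≤̄ [ y i ]) (substitute-spec (f (suc i)) g y g≡) (y≥ i)

  alternative : ∀ (f : Fin n → Term n) → Subsolution f ⊎ Supersolution f
  alternative {zero}  f = inj₁ ((λ ()) , (λ ()))
  alternative {suc n} f with alternative (Step.reduced f)
  ... | inj₁ sub   = Step.extend-sub f sub
  ... | inj₂ super = inj₂ (Step.extend-super f super)

  touching⇒⊥ : ∀ (f : Fin n → Term n) x y t i₀ →
               (∀ i → x i ≺ ⟦ f i ⟧ (fin ∘ x)) → (∀ i → ⟦ f i ⟧ y ≤̄ [ y i ]) →
               (∀ j → fin (x j + t) ≤∞ y j) → y i₀ ≡ fin (x i₀ + t) → ⊥
  touching⇒⊥ f x y t i₀ x≺ y≥ x+t≤y y≡ = ≺⇒≱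
    (≺-≤̄-trans (subst (x i₀ + t ≺_) (sym (⟦⟧-shift (f i₀) x t)) (≺-shift t (x≺ i₀))) (⟦⟧-mono (f i₀) x+t≤y))
    (subst (λ e → ⟦ f i₀ ⟧ y ≤̄ [ e ]) y≡ (y≥ i₀))

  sub×super⇒⊥ : ∀ (f : Fin n → Term n) → Subsolution f → Supersolution f → ⊥
  sub×super⇒⊥ {n} f (x , x≺) (y , y≢+∞ , y≥) = touching⇒⊥ f x y t i₀ x≺ y≥ x+t≤y y≡
    where
    gap : Fin n → ℚ∞
    gap j = y j +ᶜ (- x j)
    finite : ∃[ i ] y i ≢ +∞
    finite = ¬∀⟶∃¬ n (λ i → y i ≡ +∞) (≡+∞? ∘ y) y≢+∞
    i₁ = proj₁ finite
    i₀ = Extrema.argmin gap i₁ (allFin n)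
    gap-min : ∀ j → gap i₀ ≤∞ gap j
    gap-min j = All.lookup (Extrema.f[argmin]≤f[xs] i₁ (allFin n)) (∈-allFin j)
    gap₀-fin : ∃[ t ] gap i₀ ≡ fin t
    gap₀-fin = ≤fin⇒fin (subst (gap i₀ ≤∞_) (cong (_+ᶜ (- x i₁)) (proj₂ (≢+∞⇒fin (proj₂ finite)))) (gap-min i₁))
    t = proj₁ gap₀-fin
    x+t≤y : ∀ j → fin (x j + t) ≤∞ y j
    x+t≤y j = subst₂ _≤∞_ (cong fin (ℚ.+-comm t (x j))) (+ᶜ-neg-cancel (y j) (x j))
                          (+ᶜ-mono (x j) (subst (_≤∞ gap j) (proj₂ gap₀-fin) (gap-min j)))
    y≡ : y i₀ ≡ fin (x i₀ + t)
    y≡ = trans (sym (+ᶜ-neg-cancel (y i₀) (x i₀)))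
               (trans (cong (_+ᶜ x i₀) (proj₂ gap₀-fin)) (cong fin (ℚ.+-comm t (x i₀))))

module Operators where

  open ExtendedRationals
  open Values
  open LinearForms
  open Terms
  open Alternative using (Subsolution; Supersolution)
  open import Data.Rational using (ℚ; 0ℚ; _+_; _*_; _<_; 1/_; positive)
  import Data.Rational.Properties as ℚ
  open import Data.Nat using (ℕ)
  open import Data.Fin using (Fin)
  open import Data.List using (List; []; _∷_)
  open import Data.List.NonEmpty using (_∷_)
  open import Data.Product using (_×_; _,_; proj₁; proj₂)
  open import Function using (_∘_; _⇔_; mk⇔)
  open import Relation.Binary.PropositionalEquality

  private
    variable
      n : ℕ

  shiftᵃ : Fin n × ℚ → Affine n
  shiftᵃ (j , k) = record { coef = δ j ; coef-nonNeg = δ-nonNeg j ; coef-sum = ∑-δ j ; const = k }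

  ⟦shiftᵃ⟧ : ∀ (t : Fin n × ℚ) y → ⟦ shiftᵃ t ⟧ᵃ y ≡ y (proj₁ t) +ᶜ proj₂ t
  ⟦shiftᵃ⟧ (j , k) y = cong (_+ᶜ k) (lin-δ j y)

  maxTerm minTerm : Fin n × ℚ → List (Fin n × ℚ) → Term n
  maxTerm t []       = aff (shiftᵃ t)
  maxTerm t (u ∷ us) = aff (shiftᵃ t) ∨ maxTerm u us
  minTerm t []       = aff (shiftᵃ t)
  minTerm t (u ∷ us) = aff (shiftᵃ t) ∧ minTerm u us

  ⟦maxTerm⟧ : ∀ (t : Fin n × ℚ) ts y → ⟦ maxTerm t ts ⟧ y ≡ [ eval (maxOp (t ∷ ts)) y ]
  ⟦maxTerm⟧ t []       y = cong [_] (⟦shiftᵃ⟧ t y)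
  ⟦maxTerm⟧ t (u ∷ us) y = cong₂ _⊔̄_ (cong [_] (⟦shiftᵃ⟧ t y)) (⟦maxTerm⟧ u us y)

  ⟦minTerm⟧ : ∀ (t : Fin n × ℚ) ts y → ⟦ minTerm t ts ⟧ y ≡ [ eval (minOp (t ∷ ts)) y ]
  ⟦minTerm⟧ t []       y = cong [_] (⟦shiftᵃ⟧ t y)
  ⟦minTerm⟧ t (u ∷ us) y = cong₂ _⊓̄_ (cong [_] (⟦shiftᵃ⟧ t y)) (⟦minTerm⟧ u us y)

  weights : Fin n × ℚ>0 → List (Fin n × ℚ>0) → Fin n → ℚ
  weights (j , α , _) []       i = α * δ j i
  weights (j , α , _) (v ∷ vs) i = α * δ j i + weights v vs i

  weights-nonNeg : ∀ (w : Fin n × ℚ>0) ws → NonNeg (weights w ws)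
  weights-nonNeg (j , α , α>0) []       i = *-nonNeg (ℚ.<⇒≤ α>0) (δ-nonNeg j i)
  weights-nonNeg (j , α , α>0) (v ∷ vs) i = ℚ.+-mono-≤ (*-nonNeg (ℚ.<⇒≤ α>0) (δ-nonNeg j i)) (weights-nonNeg v vs i)

  ∑-weights : ∀ (w : Fin n × ℚ>0) ws → ∑ (weights w ws) ≡ proj₁ (totalWeight (w ∷ ws))
  ∑-weights (j , α , _) []       = trans (∑-scale α (δ j)) (trans (cong (α *_) (∑-δ j)) (ℚ.*-identityʳ α))
  ∑-weights (j , α , _) (v ∷ vs) = trans (∑-distrib-+ (λ i → α * δ j i) (weights v vs))
    (cong₂ _+_ (trans (∑-scale α (δ j)) (trans (cong (α *_) (∑-δ j)) (ℚ.*-identityʳ α))) (∑-weights v vs))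

  lin-weights : ∀ (w : Fin n × ℚ>0) ws y → lin (weights w ws) y ≡ weightedSum y (w ∷ ws)
  lin-weights (j , α , α>0) []       y = trans (lin-scale α>0 (δ j) (δ-nonNeg j) y) (cong (α ·_) (lin-δ j y))
  lin-weights (j , α , α>0) (v ∷ vs) y = trans
    (lin-distrib-+ (λ i → α * δ j i) (weights v vs) (λ i → *-nonNeg (ℚ.<⇒≤ α>0) (δ-nonNeg j i)) (weights-nonNeg v vs) y)
    (cong₂ _⊕_ (trans (lin-scale α>0 (δ j) (δ-nonNeg j) y) (cong (α ·_) (lin-δ j y))) (lin-weights v vs y))

  module Average (w : Fin n × ℚ>0) (ws : List (Fin n × ℚ>0)) where

    W : ℚ
    W = proj₁ (totalWeight (w ∷ ws))

    private instance
      W-pos     = positive (proj₂ (totalWeight (w ∷ ws)))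
      W-nonZero = ℚ.pos⇒nonZero W

    0<1/W : 0ℚ < 1/ W
    0<1/W = ℚ.positive⁻¹ (1/ W) {{ℚ.1/pos⇒pos W}}

    affine : ℚ → Affine n
    affine k = record
      { coef        = λ i → 1/ W * weights w ws i
      ; coef-nonNeg = λ i → *-nonNeg (ℚ.<⇒≤ 0<1/W) (weights-nonNeg w ws i)
      ; coef-sum    = trans (∑-scale (1/ W) (weights w ws)) (trans (cong (1/ W *_) (∑-weights w ws)) (ℚ.*-inverseˡ W))
      ; const       = k
      }

    ⟦affine⟧ : ∀ k y → ⟦ affine k ⟧ᵃ y ≡ eval (avgOp (w ∷ ws) k) y
    ⟦affine⟧ k y = cong (_+ᶜ k)
      (trans (lin-scale 0<1/W (weights w ws) (weights-nonNeg w ws) y) (cong ((1/ W) ·_) (lin-weights w ws y)))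

  toTerm : Op n → Term n
  toTerm (maxOp (t ∷ ts))   = maxTerm t ts
  toTerm (minOp (t ∷ ts))   = minTerm t ts
  toTerm (avgOp (w ∷ ws) k) = aff (Average.affine w ws k)

  ⟦toTerm⟧ : ∀ (o : Op n) y → ⟦ toTerm o ⟧ y ≡ [ eval o y ]
  ⟦toTerm⟧ (maxOp (t ∷ ts))   y = ⟦maxTerm⟧ t ts y
  ⟦toTerm⟧ (minOp (t ∷ ts))   y = ⟦minTerm⟧ t ts y
  ⟦toTerm⟧ (avgOp (w ∷ ws) k) y = cong [_] (Average.⟦affine⟧ w ws k y)

  subsolution⇔P : ∀ (o : Fin n → Op n) → Subsolution (toTerm ∘ o) ⇔ P o
  subsolution⇔P o = mk⇔
    (λ (x , x≺) → x , λ i → subst (x i ≺_) (⟦toTerm⟧ (o i) (fin ∘ x)) (x≺ i))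
    (λ (x , x<) → x , λ i → subst (x i ≺_) (sym (⟦toTerm⟧ (o i) (fin ∘ x))) (x< i))

  supersolution⇔D : ∀ (o : Fin n → Op n) → Supersolution (toTerm ∘ o) ⇔ D o
  supersolution⇔D o = mk⇔
    (λ (y , y≢+∞ , y≥) → y , y≢+∞ , λ i → [≤]-injective (subst (_≤̄ [ y i ]) (⟦toTerm⟧ (o i) y) (y≥ i)))
    (λ (y , y≢+∞ , y≥) → y , y≢+∞ , λ i → subst (_≤̄ [ y i ]) (sym (⟦toTerm⟧ (o i) y)) [ y≥ i ])

open Alternative using (alternative; sub×super⇒⊥)
open Operators using (toTerm; subsolution⇔P; supersolution⇔D)
open import Data.Nat using (ℕ; _≤_)
open import Data.Fin using (Fin)
open import Data.Product using (_×_; _,_)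
open import Data.Sum using (_⊎_)
import Data.Sum as Sum
open import Function using (_∘_; Equivalence)
open import Relation.Nullary using (¬_)

mainTheorem1 : (n : ℕ) → 1 ≤ n → (o : Fin n → Op n) →
    (P o ⊎ D o) × ¬ (P o × D o)
mainTheorem1 n _ o =
  Sum.map (Equivalence.to (subsolution⇔P o)) (Equivalence.to (supersolution⇔D o)) (alternative (toTerm ∘ o)) ,
  λ (p , d) → sub×super⇒⊥ (toTerm ∘ o) (Equivalence.from (subsolution⇔P o) p)
                                       (Equivalence.from (supersolution⇔D o) d)
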